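{- Let $G$ be the infinite grid graph with vertex set $\mathbb{Z}^2$, $\sigma$ a distinguished face, and $k$ a nonnegative integer. Let $K$ be the face configuration with $K_\sigma=k$ and $K_\tau=0$ for all faces $\tau\ne\sigma$. Then every run of the flow-firing process for $(G,\sigma)$ started from $K$ terminates after finitely many steps, and it always terminates at the same configuration $K^\bullet$, given by $$K^\bullet_\sigma=k,\qquad K^\bullet_\tau=\max\{0,\,k-\mathrm{dist}(\sigma,\tau)+1\}\ \text{ for all faces }\tau\neq\sigma.$$
   Context: Faces of $G$ are the unit squares of $\mathbb{Z}^2$; two faces are neighbors if they share an edge. $\mathrm{dist}(\sigma,\tau)$ is the distance in the dual graph of $G$ (the Manhattan distance between the squares). A face configuration assigns an integer $F_\tau$ to each face. Flow-firing process for $(G,\sigma)$ in the face representation: at each step choose two neighboring faces $a,b$, and: if $a\neq\sigma$, $b\neq\sigma$ and $F_a\ge F_b+2$, replace $F_a$ by $F_a-1$ and $F_b$ by $F_b+1$; if $b=\sigma$ and $F_\sigma>F_a$, replace $F_a$ by $F_a+1$; if $b=\sigma$ and $F_\sigma<F_a$, replace $F_a$ by $F_a-1$. The process terminates when no move is possible. (Equivalently, in edge terms: $K$ is $k$ units of flow circulating around $\sigma$; an edge not in $\sigma$ fires when it carries at least $2$ units of flow, rerouting one unit across each of its two faces; an edge of $\sigma$ fires when it carries at least $1$ unit, rerouting one unit across the face other than $\sigma$ containing it.) -}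

module Defs where

open import Data.Nat using (ℕ; zero; suc)
open import Data.Integer using (ℤ; +_; _+_; _-_; ∣_∣; _≤_; _<_; _⊔_; 0ℤ; 1ℤ)
open import Data.Integer.Properties using () renaming (_≟_ to _≟ℤ_)
open import Data.Product using (Σ; ∃; ∃-syntax; _×_; _,_; proj₁; proj₂)
open import Data.Sum using (_⊎_)
open import Relation.Nullary using (¬_; yes; no)
open import Relation.Binary.PropositionalEquality using (_≡_; _≢_)
open import Relation.Binary.Construct.Closure.ReflexiveTransitive using (Star)

-- A face of the grid ℤ² is a unit square, named by its lower-left corner.
Face : Set
Face = ℤ × ℤ

_≟F_ : (a b : Face) → Relation.Nullary.Dec (a ≡ b)
(x , y) ≟F (x' , y') with x ≟ℤ x' | y ≟ℤ y'
... | yes Relation.Binary.PropositionalEquality.refl | yes Relation.Binary.PropositionalEquality.refl = yes Relation.Binary.PropositionalEquality.refl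
... | no p | _ = no (λ { Relation.Binary.PropositionalEquality.refl → p Relation.Binary.PropositionalEquality.refl })
... | yes _ | no q = no (λ { Relation.Binary.PropositionalEquality.refl → q Relation.Binary.PropositionalEquality.refl })

Adj : Face → Face → Set
Adj (x , y) (x' , y') =
  ((x' ≡ x + 1ℤ) × (y' ≡ y)) ⊎ ((x ≡ x' + 1ℤ) × (y' ≡ y)) ⊎
  ((y' ≡ y + 1ℤ) × (x' ≡ x)) ⊎ ((y ≡ y' + 1ℤ) × (x' ≡ x))

-- Distance in the dual graph = Manhattan distance.
dist : Face → Face → ℕ
dist (x , y) (x' , y') = ∣ x - x' ∣ Data.Nat.+ ∣ y - y' ∣

Config : Set
Config = Face → ℤ

_≈_ : Config → Config → Set
F ≈ F' = ∀ τ → F τ ≡ F' τ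

addAt : Face → ℤ → Config → Config
addAt a d F τ with τ ≟F a
... | yes _ = F τ + d
... | no _  = F τ

Step : Face → Config → Config → Set
Step σ F F' = Σ Face λ a → Σ Face λ b → Adj a b ×
  (  (a ≢ σ × b ≢ σ × (F b + (+ 2) ≤ F a) ×
        F' ≈ addAt b 1ℤ (addAt a (Data.Integer.- 1ℤ) F))
   ⊎ (b ≡ σ × F a < F σ × F' ≈ addAt a 1ℤ F)
   ⊎ (b ≡ σ × F σ < F a × F' ≈ addAt a (Data.Integer.- 1ℤ) F))

Terminal : Face → Config → Set
Terminal σ F = ∀ F' → ¬ Step σ F F'

Reach : Face → Config → Config → Set
Reach σ = Star (Step σ)

initK : Face → ℕ → Config
initK σ k τ with τ ≟F σ
... | yes _ = + k
... | no _  = 0ℤ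

finalK : Face → ℕ → Config
finalK σ k τ with τ ≟F σ
... | yes _ = + k
... | no _  = ((+ k) - (+ dist σ τ) + 1ℤ) ⊔ 0ℤ

module Submission where

-- Flow-firing on the grid from k units of flow around a face σ.  Write
-- cone τ = max(0, k + 1 - dist σ τ), so that K• is k at σ and the cone elsewhere.
--
-- 1. Invariant: along every run F σ = k and 0 ≤ F τ ≤ cone τ for τ ≠ σ
--    ("admissible" configurations); in particular only faces within distance k
--    of σ carry flow, and flow is never pushed back into σ.
-- 2. Termination: the potential Φ(F) = Σ (k + 1 - F τ)², summed over the
--    (2k+1)×(2k+1) box around σ, is a nonnegative integer lowered by every move
--    from an admissible configuration, so no run is infinite.
-- 3. Uniqueness: in a terminal configuration no edge towards σ can fire, so a
--    face at distance e + 1 carries at least k - e; with the invariant this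
--    pins the configuration down to K•.

open import Defs
open import Data.Nat using (ℕ; suc; zero)
import Data.Nat as ℕ
import Data.Nat.Properties as ℕP
open import Data.Integer hiding (suc; _≟_)
open import Data.Integer.Properties
  using (≤-refl; ≤-trans; ≤-reflexive; ≤-antisym; <-irrefl; <⇒≢; <-≤-trans; ≤∧≢⇒<;
         +-monoˡ-≤; +-monoʳ-≤; +-mono-≤; +-assoc; +-identityʳ; +-inverseʳ;
         ∣i+j∣≤∣i∣+∣j∣; ∣i∣≡0⇒i≡0; i-j≡0⇒i≡j; 0≤i⇒+∣i∣≡i; i≤i+j;
         ≤-total; i≤j⇒i⊔j≡j; i≥j⇒i⊔j≡i; i≤j⇒i≤k⊔j; i≤j⇒i≤j⊔k; ⊔-lub;
         i<j⇒suc[i]≤j; suc[i]≤j⇒i<j; i<j⇒i≤pred[j]; ≰⇒>; ≮⇒≥; drop‿+≤+; +-comm; ∣i-j∣≡∣j-i∣; i≤j⇒0≤j-i; i-j≤i;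
         module ≤-Reasoning) renaming (_≟_ to _≟ℤ_)
open import Data.Integer.Tactic.RingSolver using (solve-∀)
open import Data.Product using (Σ; _×_; _,_; proj₁; proj₂)
open import Data.Sum using (_⊎_; inj₁; inj₂)
open import Data.Empty using (⊥; ⊥-elim)
open import Relation.Nullary using (¬_; yes; no)
open import Relation.Binary.PropositionalEquality
open import Relation.Binary.Construct.Closure.ReflexiveTransitive using (ε; _◅_)
open import Function using (case_of_)

adj-sym : ∀ {a b} → Adj a b → Adj b a
adj-sym (inj₁ (p , q))               = inj₂ (inj₁ (p , sym q))
adj-sym (inj₂ (inj₁ (p , q)))        = inj₁ (p , sym q)
adj-sym (inj₂ (inj₂ (inj₁ (p , q)))) = inj₂ (inj₂ (inj₂ (p , sym q)))
adj-sym (inj₂ (inj₂ (inj₂ (p , q)))) = inj₂ (inj₂ (inj₁ (p , sym q)))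

i<i+1 : ∀ i → i < i + 1ℤ
i<i+1 i = suc[i]≤j⇒i<j (≤-reflexive (+-comm 1ℤ i))

adj-irrefl : ∀ {a} → ¬ Adj a a
adj-irrefl {x , y} (inj₁ (x≡x+1 , _))               = <⇒≢ (i<i+1 x) x≡x+1
adj-irrefl {x , y} (inj₂ (inj₁ (x≡x+1 , _)))        = <⇒≢ (i<i+1 x) x≡x+1
adj-irrefl {x , y} (inj₂ (inj₂ (inj₁ (y≡y+1 , _)))) = <⇒≢ (i<i+1 y) y≡y+1
adj-irrefl {x , y} (inj₂ (inj₂ (inj₂ (y≡y+1 , _)))) = <⇒≢ (i<i+1 y) y≡y+1

adj-distinct : ∀ {a b} → Adj a b → a ≢ b
adj-distinct adj refl = adj-irrefl adj

∣i+unit∣≤1+∣i∣ : ∀ i j → ∣ j ∣ ≡ 1 → ∣ i + j ∣ ℕ.≤ suc ∣ i ∣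
∣i+unit∣≤1+∣i∣ i j ∣j∣≡1 =
  ℕP.≤-trans (∣i+j∣≤∣i∣+∣j∣ i j)
             (ℕP.≤-reflexive (trans (cong (∣ i ∣ ℕ.+_) ∣j∣≡1) (ℕP.+-comm ∣ i ∣ 1)))

coord-step : ∀ s x → ∣ s - x ∣ ℕ.≤ suc ∣ s - (x + 1ℤ) ∣ × ∣ s - (x + 1ℤ) ∣ ℕ.≤ suc ∣ s - x ∣
coord-step s x =
  subst (λ i → ∣ i ∣ ℕ.≤ suc ∣ s - (x + 1ℤ) ∣) (sym (back s x)) (∣i+unit∣≤1+∣i∣ (s - (x + 1ℤ)) 1ℤ refl) ,
  subst (λ i → ∣ i ∣ ℕ.≤ suc ∣ s - x ∣) (sym (forth s x)) (∣i+unit∣≤1+∣i∣ (s - x) -1ℤ refl)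
  where
  back : ∀ s x → s - x ≡ (s - (x + 1ℤ)) + 1ℤ
  back = solve-∀
  forth : ∀ s x → s - (x + 1ℤ) ≡ (s - x) + -1ℤ
  forth = solve-∀

dist-adj : ∀ σ {a b} → Adj a b → dist σ a ℕ.≤ suc (dist σ b)
dist-adj (sx , sy) {x , y} {x' , y'} (inj₁ (refl , refl)) =
  ℕP.+-monoˡ-≤ ∣ sy - y ∣ (proj₁ (coord-step sx x))
dist-adj (sx , sy) {x , y} {x' , y'} (inj₂ (inj₁ (refl , refl))) =
  ℕP.+-monoˡ-≤ ∣ sy - y ∣ (proj₂ (coord-step sx x'))
dist-adj (sx , sy) {x , y} {x' , y'} (inj₂ (inj₂ (inj₁ (refl , refl)))) =
  ℕP.≤-trans (ℕP.+-monoʳ-≤ ∣ sx - x ∣ (proj₁ (coord-step sy y)))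
             (ℕP.≤-reflexive (ℕP.+-suc ∣ sx - x ∣ _))
dist-adj (sx , sy) {x , y} {x' , y'} (inj₂ (inj₂ (inj₂ (refl , refl)))) =
  ℕP.≤-trans (ℕP.+-monoʳ-≤ ∣ sx - x ∣ (proj₂ (coord-step sy y')))
             (ℕP.≤-reflexive (ℕP.+-suc ∣ sx - x ∣ _))

dist-self : ∀ σ → dist σ σ ≡ 0
dist-self (sx , sy) rewrite +-inverseʳ sx | +-inverseʳ sy = refl

dist≡0⇒≡ : ∀ σ τ → dist σ τ ≡ 0 → τ ≡ σ
dist≡0⇒≡ (sx , sy) (x , y) d≡0 =
  cong₂ _,_ (coord≡ sx x (ℕP.m+n≡0⇒m≡0 ∣ sx - x ∣ d≡0)) (coord≡ sy y (ℕP.m+n≡0⇒n≡0 ∣ sx - x ∣ d≡0))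
  where
  coord≡ : ∀ s x → ∣ s - x ∣ ≡ 0 → x ≡ s
  coord≡ s x h = sym (i-j≡0⇒i≡j s x (∣i∣≡0⇒i≡0 h))

dist-pos : ∀ σ τ → τ ≢ σ → 1 ℕ.≤ dist σ τ
dist-pos σ τ τ≢σ with dist σ τ in d
... | zero  = ⊥-elim (τ≢σ (dist≡0⇒≡ σ τ d))
... | suc _ = ℕ.s≤s ℕ.z≤n

coord-toward : ∀ s x n → ∣ s - x ∣ ≡ suc n →
  Σ ℤ λ x' → (x' ≡ x + 1ℤ ⊎ x ≡ x' + 1ℤ) × ∣ s - x' ∣ ≡ n
coord-toward s x n h with s - x in eq
... | +[1+ m ] = x + 1ℤ , inj₁ refl ,
      trans (cong ∣_∣ (trans (up s x) (cong (_- 1ℤ) eq))) (ℕP.suc-injective h)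
  where
  up : ∀ s x → s - (x + 1ℤ) ≡ (s - x) - 1ℤ
  up = solve-∀
... | -[1+ m ] = x - 1ℤ , inj₂ (down x) ,
      trans (cong ∣_∣ (trans (down' s x) (cong (_+ 1ℤ) eq))) (trans (∣-[1+m]+1∣ m) (ℕP.suc-injective h))
  where
  down : ∀ x → x ≡ (x - 1ℤ) + 1ℤ
  down = solve-∀
  down' : ∀ s x → s - (x - 1ℤ) ≡ (s - x) + 1ℤ
  down' = solve-∀
  ∣-[1+m]+1∣ : ∀ m → ∣ -[1+ m ] + 1ℤ ∣ ≡ m
  ∣-[1+m]+1∣ zero    = refl
  ∣-[1+m]+1∣ (suc m) = refl
... | +0 with () ← h

step-toward : ∀ σ τ e → dist σ τ ≡ suc e → Σ Face λ τ' → Adj τ' τ × dist σ τ' ≡ e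
step-toward (sx , sy) (x , y) e h with ∣ sx - x ∣ in dx
... | suc n with coord-toward sx x n dx
...   | x' , move , d = (x' , y) , horizontal move , trans (cong (ℕ._+ ∣ sy - y ∣) d) (ℕP.suc-injective h)
  where
  horizontal : (x' ≡ x + 1ℤ ⊎ x ≡ x' + 1ℤ) → Adj (x' , y) (x , y)
  horizontal (inj₁ p) = inj₂ (inj₁ (p , refl))
  horizontal (inj₂ p) = inj₁ (p , refl)
step-toward (sx , sy) (x , y) e h | zero with coord-toward sy y e h
...   | y' , move , d = (x , y') , vertical move , trans (cong (ℕ._+ ∣ sy - y' ∣) dx) d
  where
  vertical : (y' ≡ y + 1ℤ ⊎ y ≡ y' + 1ℤ) → Adj (x , y') (x , y)
  vertical (inj₁ p) = inj₂ (inj₂ (inj₂ (p , refl)))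
  vertical (inj₂ p) = inj₂ (inj₂ (inj₁ (p , refl)))

move-right : ∀ i j k → i + j ≤ k → i ≤ k - j
move-right i j k h = ≤-trans (≤-reflexive (cancel i j)) (+-monoˡ-≤ (- j) h)
  where
  cancel : ∀ i j → i ≡ i + j - j
  cancel = solve-∀

move-left : ∀ i j k → i ≤ k - j → i + j ≤ k
move-left i j k h = ≤-trans (+-monoˡ-≤ j h) (≤-reflexive (cancel k j))
  where
  cancel : ∀ k j → k - j + j ≡ k
  cancel = solve-∀

+-cancelʳ-≤ : ∀ i j k → i + j ≤ k + j → i ≤ k
+-cancelʳ-≤ i j k h = ≤-trans (move-right i j (k + j) h) (≤-reflexive (cancel k j))
  where
  cancel : ∀ k j → k + j - j ≡ k
  cancel = solve-∀

initK-σ : ∀ σ k → initK σ k σ ≡ + k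
initK-σ σ k with σ ≟F σ
... | yes _   = refl
... | no σ≢σ = ⊥-elim (σ≢σ refl)

initK-off : ∀ σ k τ → τ ≢ σ → initK σ k τ ≡ 0ℤ
initK-off σ k τ τ≢σ with τ ≟F σ
... | yes τ≡σ = ⊥-elim (τ≢σ τ≡σ)
... | no _    = refl

finalK-σ : ∀ σ k → finalK σ k σ ≡ + k
finalK-σ σ k with σ ≟F σ
... | yes _   = refl
... | no σ≢σ = ⊥-elim (σ≢σ refl)

addAt-here : ∀ a d F → addAt a d F a ≡ F a + d
addAt-here a d F with a ≟F a
... | yes _   = refl
... | no a≢a = ⊥-elim (a≢a refl)

addAt-off : ∀ a d F τ → τ ≢ a → addAt a d F τ ≡ F τ
addAt-off a d F τ τ≢a with τ ≟F a
... | yes τ≡a = ⊥-elim (τ≢a τ≡a)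
... | no _    = refl

cone : Face → ℕ → Face → ℤ
cone σ k τ = ((+ k) - (+ dist σ τ) + 1ℤ) ⊔ 0ℤ

finalK-off : ∀ σ k τ → τ ≢ σ → finalK σ k τ ≡ cone σ k τ
finalK-off σ k τ τ≢σ with τ ≟F σ
... | yes τ≡σ = ⊥-elim (τ≢σ τ≡σ)
... | no _    = refl

cone-nonneg : ∀ σ k τ → 0ℤ ≤ cone σ k τ
cone-nonneg σ k τ = i≤j⇒i≤k⊔j _ ≤-refl

positive≤⊔0⇒≤ : ∀ {v c} → 1ℤ ≤ v → v ≤ c ⊔ 0ℤ → v ≤ c
positive≤⊔0⇒≤ {v} {c} 1≤v v≤c⊔0 with ≤-total c 0ℤ
... | inj₁ c≤0 with () ← drop‿+≤+ (≤-trans 1≤v (≤-trans v≤c⊔0 (≤-reflexive (i≤j⇒i⊔j≡j c≤0))))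
... | inj₂ 0≤c = ≤-trans v≤c⊔0 (≤-reflexive (i≥j⇒i⊔j≡i 0≤c))

cone-sound : ∀ σ k τ v → 1ℤ ≤ v → v ≤ cone σ k τ → v + + dist σ τ ≤ + k + 1ℤ
cone-sound σ k τ v 1≤v v≤cone =
  move-left v (+ dist σ τ) (+ k + 1ℤ)
    (≤-trans (positive≤⊔0⇒≤ 1≤v v≤cone) (≤-reflexive (rearrange (+ k) (+ dist σ τ))))
  where
  rearrange : ∀ k d → k - d + 1ℤ ≡ k + 1ℤ - d
  rearrange = solve-∀

cone-complete : ∀ σ k τ v → v + + dist σ τ ≤ + k + 1ℤ → v ≤ cone σ k τ
cone-complete σ k τ v h =
  i≤j⇒i≤j⊔k 0ℤ (≤-trans (move-right v (+ dist σ τ) (+ k + 1ℤ) h) (≤-reflexive (rearrange (+ k) (+ dist σ τ))))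
  where
  rearrange : ∀ k d → k + 1ℤ - d ≡ k - d + 1ℤ
  rearrange = solve-∀

cone-support : ∀ σ k τ v → 1ℤ ≤ v → v ≤ cone σ k τ → dist σ τ ℕ.≤ k
cone-support σ k τ v 1≤v v≤cone =
  ℕ.s≤s⁻¹ (ℕP.≤-trans (drop‿+≤+ (≤-trans (+-monoˡ-≤ (+ dist σ τ) 1≤v) (cone-sound σ k τ v 1≤v v≤cone)))
                      (ℕP.≤-reflexive (ℕP.+-comm k 1)))

Admissible : Face → ℕ → Config → Set
Admissible σ k F = (F σ ≡ + k) × (∀ τ → τ ≢ σ → (0ℤ ≤ F τ) × (F τ ≤ cone σ k τ))

admissible-initK : ∀ σ k → Admissible σ k (initK σ k)
admissible-initK σ k =
  initK-σ σ k , λ τ τ≢σ → subst (λ v → (0ℤ ≤ v) × (v ≤ cone σ k τ)) (sym (initK-off σ k τ τ≢σ))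
                              (≤-refl , cone-nonneg σ k τ)

admissible-resp-≈ : ∀ {σ k F G} → F ≈ G → Admissible σ k F → Admissible σ k G
admissible-resp-≈ {σ} {k} F≈G (Fσ , bounded) =
  trans (sym (F≈G σ)) Fσ ,
  λ τ τ≢σ → subst (λ v → (0ℤ ≤ v) × (v ≤ cone σ k τ)) (F≈G τ) (bounded τ τ≢σ)

admissible-addAt : ∀ {σ k F} c d → Admissible σ k F → c ≢ σ →
  0ℤ ≤ F c + d → F c + d ≤ cone σ k c → Admissible σ k (addAt c d F)
admissible-addAt {σ} {k} {F} c d (Fσ , bounded) c≢σ 0≤v v≤cone =
  trans (addAt-off c d F σ (λ σ≡c → c≢σ (sym σ≡c))) Fσ , bounded'
  where
  bounded' : ∀ τ → τ ≢ σ → (0ℤ ≤ addAt c d F τ) × (addAt c d F τ ≤ cone σ k τ)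
  bounded' τ τ≢σ = case τ ≟F c of λ
    { (yes refl) → subst (λ v → (0ℤ ≤ v) × (v ≤ cone σ k c)) (sym (addAt-here c d F)) (0≤v , v≤cone)
    ; (no τ≢c)   → subst (λ v → (0ℤ ≤ v) × (v ≤ cone σ k τ)) (sym (addAt-off c d F τ τ≢c)) (bounded τ τ≢σ)
    }

intervalSum : (ℤ → ℤ) → ℤ → ℕ → ℤ
intervalSum f lo zero    = 0ℤ
intervalSum f lo (suc n) = f lo + intervalSum f (lo + 1ℤ) n

intervalSum-cong : ∀ {f g} lo n → (∀ x → f x ≡ g x) → intervalSum f lo n ≡ intervalSum g lo n
intervalSum-cong lo zero    f≗g = refl
intervalSum-cong lo (suc n) f≗g = cong₂ _+_ (f≗g lo) (intervalSum-cong (lo + 1ℤ) n f≗g)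

intervalSum-nonneg : ∀ f lo n → (∀ x → 0ℤ ≤ f x) → 0ℤ ≤ intervalSum f lo n
intervalSum-nonneg f lo zero    f≥0 = ≤-refl
intervalSum-nonneg f lo (suc n) f≥0 = +-mono-≤ (f≥0 lo) (intervalSum-nonneg f (lo + 1ℤ) n f≥0)

intervalSum-outside : ∀ {f g c} lo n → (∀ x → x ≢ c → g x ≡ f x) → c < lo →
  intervalSum g lo n ≡ intervalSum f lo n
intervalSum-outside lo zero    agree c<lo = refl
intervalSum-outside lo (suc n) agree c<lo =
  cong₂ _+_ (agree lo (λ lo≡c → <⇒≢ c<lo (sym lo≡c)))
            (intervalSum-outside (lo + 1ℤ) n agree (<-≤-trans c<lo (i≤i+j lo 1ℤ)))

intervalSum-update : ∀ {f g c} lo n → (∀ x → x ≢ c → g x ≡ f x) → lo ≤ c → c < lo + + n →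
  intervalSum g lo n ≡ intervalSum f lo n + (g c - f c)
intervalSum-update {c = c} lo zero agree lo≤c c<lo+0 =
  ⊥-elim (<-irrefl refl (<-≤-trans c<lo+0 (≤-trans (≤-reflexive (+-identityʳ lo)) lo≤c)))
intervalSum-update {f} {g} {c} lo (suc n) agree lo≤c c<end with lo ≟ℤ c
... | yes refl =
  trans (cong (λ s → g lo + s) (intervalSum-outside (lo + 1ℤ) n agree (i<i+1 lo)))
        (regroup (g lo) (f lo) (intervalSum f (lo + 1ℤ) n))
  where
  regroup : ∀ a b s → a + s ≡ b + s + (a - b)
  regroup = solve-∀
... | no lo≢c =
  trans (cong₂ _+_ (agree lo lo≢c) (intervalSum-update (lo + 1ℤ) n agree lo+1≤c c<end'))
        (sym (+-assoc (f lo) (intervalSum f (lo + 1ℤ) n) _))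
  where
  lo+1≤c : lo + 1ℤ ≤ c
  lo+1≤c = ≤-trans (≤-reflexive (+-comm lo 1ℤ)) (i<j⇒suc[i]≤j (≤∧≢⇒< lo≤c lo≢c))
  c<end' : c < lo + 1ℤ + + n
  c<end' = <-≤-trans c<end (≤-reflexive (sym (+-assoc lo 1ℤ (+ n))))

weight : ℕ → ℤ → ℤ
weight k v = (+ k + 1ℤ - v) * (+ k + 1ℤ - v)

weight-nonneg : ∀ k v → 0ℤ ≤ weight k v
weight-nonneg k v with + k + 1ℤ - v
... | +0       = ≤-refl
... | +[1+ n ] = +≤+ ℕ.z≤n
... | -[1+ n ] = +≤+ ℕ.z≤n

-- The side length 2k + 1 of the box of faces within ℓ∞-distance k of σ.
boxWidth : ℕ → ℕ
boxWidth k = k ℕ.+ suc k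

potential : Face → ℕ → Config → ℤ
potential (sx , sy) k F =
  intervalSum (λ y → intervalSum (λ x → weight k (F (x , y))) (sx - + k) (boxWidth k)) (sy - + k) (boxWidth k)

potential-nonneg : ∀ σ k F → 0ℤ ≤ potential σ k F
potential-nonneg (sx , sy) k F =
  intervalSum-nonneg _ (sy - + k) (boxWidth k)
    (λ y → intervalSum-nonneg _ (sx - + k) (boxWidth k) (λ x → weight-nonneg k (F (x , y))))

potential-resp-≈ : ∀ σ k {F G} → F ≈ G → potential σ k F ≡ potential σ k G
potential-resp-≈ (sx , sy) k F≈G =
  intervalSum-cong (sy - + k) (boxWidth k)
    (λ y → intervalSum-cong (sx - + k) (boxWidth k) (λ x → cong (weight k) (F≈G (x , y))))

∣i∣≤k⇒i≤k : ∀ i k → ∣ i ∣ ℕ.≤ k → i ≤ + k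
∣i∣≤k⇒i≤k (+ n)    k h = +≤+ h
∣i∣≤k⇒i≤k -[1+ n ] k h = -≤+

coord-in-box : ∀ s a k → ∣ s - a ∣ ℕ.≤ k → (s - + k ≤ a) × (a < s - + k + + boxWidth k)
coord-in-box s a k h = lower , suc[i]≤j⇒i<j upper
  where
  open ≤-Reasoning
  s-a≤k : s - a ≤ + k
  s-a≤k = ∣i∣≤k⇒i≤k (s - a) k h
  a-s≤k : a - s ≤ + k
  a-s≤k = ∣i∣≤k⇒i≤k (a - s) k (subst (ℕ._≤ k) (∣i-j∣≡∣j-i∣ s a) h)
  split₁ : ∀ s a K → s - K ≡ (s - a) + (a - K)
  split₁ = solve-∀
  split₂ : ∀ K a → K + (a - K) ≡ a
  split₂ = solve-∀
  split₃ : ∀ s a → 1ℤ + a ≡ (a - s) + (s + 1ℤ)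
  split₃ = solve-∀
  split₄ : ∀ s K → K + (s + 1ℤ) ≡ s - K + (K + (1ℤ + K))
  split₄ = solve-∀
  lower : s - + k ≤ a
  lower = begin
    s - + k           ≡⟨ split₁ s a (+ k) ⟩
    (s - a) + (a - + k) ≤⟨ +-monoˡ-≤ (a - + k) s-a≤k ⟩
    + k + (a - + k)   ≡⟨ split₂ (+ k) a ⟩
    a                 ∎
  upper : 1ℤ + a ≤ s - + k + + boxWidth k
  upper = begin
    1ℤ + a                        ≡⟨ split₃ s a ⟩
    (a - s) + (s + 1ℤ)            ≤⟨ +-monoˡ-≤ (s + 1ℤ) a-s≤k ⟩
    + k + (s + 1ℤ)                ≡⟨ split₄ s (+ k) ⟩
    s - + k + (+ k + (1ℤ + + k))  ∎

potential-update : ∀ σ k F G c → (∀ τ → τ ≢ c → G τ ≡ F τ) → dist σ c ℕ.≤ k →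
  potential σ k G ≡ potential σ k F + (weight k (G c) - weight k (F c))
potential-update (sx , sy) k F G (cx , cy) agree c-near =
  trans (intervalSum-update (sy - + k) (boxWidth k) rows-agree (proj₁ cy-in) (proj₂ cy-in))
        (trans (cong (λ r → potential (sx , sy) k F + (r - row F cy)) row-cy)
               (cancel (potential (sx , sy) k F) (row F cy) _))
  where
  cancel : ∀ P r δ → P + ((r + δ) - r) ≡ P + δ
  cancel = solve-∀
  row : Config → ℤ → ℤ
  row H y = intervalSum (λ x → weight k (H (x , y))) (sx - + k) (boxWidth k)
  cx-in = coord-in-box sx cx k (ℕP.m+n≤o⇒m≤o ∣ sx - cx ∣ c-near)
  cy-in = coord-in-box sy cy k (ℕP.m+n≤o⇒n≤o ∣ sx - cx ∣ c-near)
  rows-agree : ∀ y → y ≢ cy → row G y ≡ row F y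
  rows-agree y y≢cy = intervalSum-cong (sx - + k) (boxWidth k)
    (λ x → cong (weight k) (agree (x , y) (λ p → y≢cy (cong proj₂ p))))
  row-cy : row G cy ≡ row F cy + (weight k (G (cx , cy)) - weight k (F (cx , cy)))
  row-cy = intervalSum-update (sx - + k) (boxWidth k)
    (λ x x≢cx → cong (weight k) (agree (x , cy) (λ p → x≢cx (cong proj₁ p)))) (proj₁ cx-in) (proj₂ cx-in)

potential-addAt : ∀ σ k F c d → dist σ c ℕ.≤ k →
  potential σ k (addAt c d F) ≡ potential σ k F + (weight k (F c + d) - weight k (F c))
potential-addAt σ k F c d c-near =
  trans (potential-update σ k F (addAt c d F) c (addAt-off c d F) c-near)
        (cong (λ v → potential σ k F + (weight k v - weight k (F c))) (addAt-here c d F))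

Progress : Face → ℕ → Config → Config → Set
Progress σ k F F' = Admissible σ k F' × (potential σ k F' + 1ℤ ≤ potential σ k F)

-- Since b is at most one step farther from σ than a and
-- F b + 1 ≤ F a - 1, the new value at b stays below the cone; the potential
-- drops by 2 (F a - F b - 2) + 2.
fire-interior : ∀ {σ k F F' a b} → Admissible σ k F → Adj a b → a ≢ σ → b ≢ σ →
  F b + + 2 ≤ F a → F' ≈ addAt b 1ℤ (addAt a (- 1ℤ) F) → Progress σ k F F'
fire-interior {σ} {k} {F} {F'} {a} {b} adm adj a≢σ b≢σ b+2≤a F'≈ =
  admissible-resp-≈ (λ τ → sym (F'≈ τ)) adm' , decrease
  where
  open ≤-Reasoning
  G : Config
  G = addAt a (- 1ℤ) F
  0≤Fb : 0ℤ ≤ F b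
  0≤Fb = proj₁ (proj₂ adm b b≢σ)
  Fa≤cone : F a ≤ cone σ k a
  Fa≤cone = proj₂ (proj₂ adm a a≢σ)
  1≤Fa : 1ℤ ≤ F a
  1≤Fa = ≤-trans (+-mono-≤ 0≤Fb (+≤+ (ℕ.s≤s ℕ.z≤n))) b+2≤a
  Fb+1-near : (F b + 1ℤ) + + dist σ b ≤ + k + 1ℤ
  Fb+1-near = begin
    (F b + 1ℤ) + + dist σ b        ≤⟨ +-monoʳ-≤ (F b + 1ℤ) (+≤+ (dist-adj σ (adj-sym adj))) ⟩
    (F b + 1ℤ) + (1ℤ + + dist σ a) ≡⟨ regroup (F b) (+ dist σ a) ⟩
    (F b + + 2) + + dist σ a       ≤⟨ +-monoˡ-≤ (+ dist σ a) b+2≤a ⟩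
    F a + + dist σ a               ≤⟨ cone-sound σ k a (F a) 1≤Fa Fa≤cone ⟩
    + k + 1ℤ                       ∎
    where
    regroup : ∀ x d → (x + 1ℤ) + (1ℤ + d) ≡ (x + + 2) + d
    regroup = solve-∀
  Fb+1≤cone : F b + 1ℤ ≤ cone σ k b
  Fb+1≤cone = cone-complete σ k b (F b + 1ℤ) Fb+1-near
  Gb≡Fb : G b ≡ F b
  Gb≡Fb = addAt-off a (- 1ℤ) F b (adj-distinct (adj-sym adj))
  adm-G : Admissible σ k G
  adm-G = admissible-addAt a (- 1ℤ) adm a≢σ (i≤j⇒0≤j-i 1≤Fa) (≤-trans (i-j≤i (F a) 1ℤ) Fa≤cone)
  adm' : Admissible σ k (addAt b 1ℤ G)
  adm' = admissible-addAt b 1ℤ adm-G b≢σ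
           (subst (λ v → 0ℤ ≤ v + 1ℤ) (sym Gb≡Fb) (≤-trans 0≤Fb (i≤i+j (F b) 1ℤ)))
           (subst (λ v → v + 1ℤ ≤ cone σ k b) (sym Gb≡Fb) Fb+1≤cone)
  potential-F' : potential σ k F' ≡ potential σ k F + (weight k (F a - 1ℤ) - weight k (F a))
                                                    + (weight k (F b + 1ℤ) - weight k (F b))
  potential-F' =
    trans (potential-resp-≈ σ k F'≈)
      (trans (potential-addAt σ k G b 1ℤ (cone-support σ k b (F b + 1ℤ) (+-monoˡ-≤ 1ℤ 0≤Fb) Fb+1≤cone))
             (cong₂ (λ p v → p + (weight k (v + 1ℤ) - weight k v))
                    (potential-addAt σ k F a (- 1ℤ) (cone-support σ k a (F a) 1≤Fa Fa≤cone)) Gb≡Fb))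
  excess : ℤ
  excess = F a - (F b + + 2)
  decrease : potential σ k F' + 1ℤ ≤ potential σ k F
  decrease = begin
    potential σ k F' + 1ℤ                          ≡⟨ cong (_+ 1ℤ) potential-F' ⟩
    _                                              ≡⟨ balance (potential σ k F) (+ k) (F a) (F b) ⟩
    potential σ k F - (excess + excess + 1ℤ)       ≤⟨ i-j≤i _ _ ⦃ nonNegative (+-mono-≤ (+-mono-≤ 0≤excess 0≤excess) (+≤+ ℕ.z≤n)) ⦄ ⟩
    potential σ k F                                ∎
    where
    0≤excess : 0ℤ ≤ excess
    0≤excess = i≤j⇒0≤j-i b+2≤a
    balance : ∀ P K x y →
      P + ((K + 1ℤ - (x - 1ℤ)) * (K + 1ℤ - (x - 1ℤ)) - (K + 1ℤ - x) * (K + 1ℤ - x))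
        + ((K + 1ℤ - (y + 1ℤ)) * (K + 1ℤ - (y + 1ℤ)) - (K + 1ℤ - y) * (K + 1ℤ - y)) + 1ℤ
      ≡ P - ((x - (y + + 2)) + (x - (y + + 2)) + 1ℤ)
    balance = solve-∀

-- Moving one unit into a neighbour a of σ with F a < F σ = k keeps a below
-- the cone (which is k there) and lowers the potential by 2 (k - F a).
fire-in : ∀ {σ k F F' a} → Admissible σ k F → Adj a σ → F a < F σ →
  F' ≈ addAt a 1ℤ F → Progress σ k F F'
fire-in {σ} {k} {F} {F'} {a} adm adj Fa<Fσ F'≈ =
  admissible-resp-≈ (λ τ → sym (F'≈ τ)) adm' , decrease
  where
  open ≤-Reasoning
  a≢σ : a ≢ σ
  a≢σ = adj-distinct adj
  0≤Fa : 0ℤ ≤ F a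
  0≤Fa = proj₁ (proj₂ adm a a≢σ)
  Fa+1≤k : F a + 1ℤ ≤ + k
  Fa+1≤k = ≤-trans (≤-reflexive (+-comm (F a) 1ℤ))
                   (subst (λ v → 1ℤ + F a ≤ v) (proj₁ adm) (i<j⇒suc[i]≤j Fa<Fσ))
  a-close : dist σ a ℕ.≤ 1
  a-close = subst (λ d → dist σ a ℕ.≤ suc d) (dist-self σ) (dist-adj σ adj)
  Fa+1≤cone : F a + 1ℤ ≤ cone σ k a
  Fa+1≤cone = cone-complete σ k a (F a + 1ℤ) (+-mono-≤ Fa+1≤k (+≤+ a-close))
  adm' : Admissible σ k (addAt a 1ℤ F)
  adm' = admissible-addAt a 1ℤ adm a≢σ (≤-trans 0≤Fa (i≤i+j (F a) 1ℤ)) Fa+1≤cone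
  slack : ℤ
  slack = + k - (F a + 1ℤ)
  decrease : potential σ k F' + 1ℤ ≤ potential σ k F
  decrease = begin
    potential σ k F' + 1ℤ
      ≡⟨ cong (_+ 1ℤ) (trans (potential-resp-≈ σ k F'≈)
           (potential-addAt σ k F a 1ℤ (cone-support σ k a (F a + 1ℤ) (+-monoˡ-≤ 1ℤ 0≤Fa) Fa+1≤cone))) ⟩
    _ ≡⟨ balance (potential σ k F) (+ k) (F a) ⟩
    potential σ k F - (slack + slack + + 2)
      ≤⟨ i-j≤i _ _ ⦃ nonNegative (+-mono-≤ (+-mono-≤ 0≤slack 0≤slack) (+≤+ ℕ.z≤n)) ⦄ ⟩
    potential σ k F ∎
    where
    0≤slack : 0ℤ ≤ slack
    0≤slack = i≤j⇒0≤j-i Fa+1≤k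
    balance : ∀ P K x →
      P + ((K + 1ℤ - (x + 1ℤ)) * (K + 1ℤ - (x + 1ℤ)) - (K + 1ℤ - x) * (K + 1ℤ - x)) + 1ℤ
      ≡ P - ((K - (x + 1ℤ)) + (K - (x + 1ℤ)) + + 2)
    balance = solve-∀

-- Under the invariant a neighbour a of σ carries at most k + 1 - dist σ a ≤ k
-- = F σ, so the move pushing flow from a into σ never applies.
no-fire-out : ∀ {σ k F a} → Admissible σ k F → Adj a σ → ¬ (F σ < F a)
no-fire-out {σ} {k} {F} {a} adm adj Fσ<Fa = <-irrefl refl (suc[i]≤j⇒i<j k+1≤k)
  where
  open ≤-Reasoning
  a≢σ : a ≢ σ
  a≢σ = adj-distinct adj
  k+1≤Fa : 1ℤ + + k ≤ F a
  k+1≤Fa = subst (λ v → 1ℤ + v ≤ F a) (proj₁ adm) (i<j⇒suc[i]≤j Fσ<Fa)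
  chain : (1ℤ + + k) + 1ℤ ≤ + k + 1ℤ
  chain = begin
    (1ℤ + + k) + 1ℤ  ≤⟨ +-monoˡ-≤ 1ℤ k+1≤Fa ⟩
    F a + 1ℤ         ≤⟨ +-monoʳ-≤ (F a) (+≤+ (dist-pos σ a a≢σ)) ⟩
    F a + + dist σ a ≤⟨ cone-sound σ k a (F a) (≤-trans (+≤+ (ℕ.s≤s ℕ.z≤n)) k+1≤Fa) (proj₂ (proj₂ adm a a≢σ)) ⟩
    + k + 1ℤ         ∎
  k+1≤k : 1ℤ + + k ≤ + k
  k+1≤k = +-cancelʳ-≤ (1ℤ + + k) 1ℤ (+ k) chain

step-progress : ∀ {σ k F F'} → Admissible σ k F → Step σ F F' → Progress σ k F F'
step-progress adm (a , b , adj , inj₁ (a≢σ , b≢σ , b+2≤a , F'≈)) = fire-interior adm adj a≢σ b≢σ b+2≤a F'≈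
step-progress adm (a , _ , adj , inj₂ (inj₁ (refl , Fa<Fσ , F'≈)))   = fire-in adm adj Fa<Fσ F'≈
step-progress adm (a , _ , adj , inj₂ (inj₂ (refl , Fσ<Fa , _)))     = ⊥-elim (no-fire-out adm adj Fσ<Fa)

reach-admissible : ∀ {σ k F G} → Admissible σ k F → Reach σ F G → Admissible σ k G
reach-admissible adm ε            = adm
reach-admissible adm (step ◅ run) = reach-admissible (proj₁ (step-progress adm step)) run

no-infinite-descent : (f : ℕ → ℤ) → (∀ n → 0ℤ ≤ f n) → (∀ n → f (suc n) + 1ℤ ≤ f n) → ⊥
no-infinite-descent f f≥0 descent = ℕP.<-irrefl refl (drop‿+≤+ too-far)
  where
  open ≤-Reasoning
  dropped : ∀ n → f n + + n ≤ f 0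
  dropped zero    = ≤-reflexive (+-identityʳ (f 0))
  dropped (suc n) = begin
    f (suc n) + + suc n   ≡⟨ sym (+-assoc (f (suc n)) 1ℤ (+ n)) ⟩
    f (suc n) + 1ℤ + + n  ≤⟨ +-monoˡ-≤ (+ n) (descent n) ⟩
    f n + + n             ≤⟨ dropped n ⟩
    f 0                   ∎
  m : ℕ
  m = ∣ f 0 ∣
  too-far : + suc m ≤ + m
  too-far = begin
    + suc m              ≤⟨ +-monoˡ-≤ (+ suc m) (f≥0 (suc m)) ⟩
    f (suc m) + + suc m  ≤⟨ dropped (suc m) ⟩
    f 0                  ≡⟨ sym (0≤i⇒+∣i∣≡i (f≥0 0)) ⟩
    + m                  ∎

no-infinite-run : ∀ σ k (s : ℕ → Config) → s 0 ≈ initK σ k → ¬ (∀ n → Step σ (s n) (s (suc n)))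
no-infinite-run σ k s s0≈K steps =
  no-infinite-descent (λ n → potential σ k (s n)) (λ n → potential-nonneg σ k (s n))
    (λ n → proj₂ (step-progress (admissible n) (steps n)))
  where
  admissible : ∀ n → Admissible σ k (s n)
  admissible zero    = admissible-resp-≈ (λ τ → sym (s0≈K τ)) (admissible-initK σ k)
  admissible (suc n) = proj₁ (step-progress (admissible n) (steps n))

positive-dist⇒≢ : ∀ σ τ {e} → dist σ τ ≡ suc e → τ ≢ σ
positive-dist⇒≢ σ τ d refl with () ← trans (sym (dist-self σ)) d

-- In a terminal configuration with F σ = k, a face at distance e + 1 from σ
-- carries at least k - e: otherwise the edge towards a neighbour one step
-- closer to σ could still fire.
terminal-lower-bound : ∀ {σ k F} → Terminal σ F → F σ ≡ + k →
  ∀ e τ → dist σ τ ≡ suc e → + k ≤ F τ + + e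
terminal-lower-bound {σ} {k} {F} term Fσ zero τ d with step-toward σ τ zero d
... | τ' , adj , d' = begin
    + k        ≡⟨ sym Fσ ⟩
    F σ        ≤⟨ ≮⇒≥ no-fire-in ⟩
    F τ        ≡⟨ sym (+-identityʳ (F τ)) ⟩
    F τ + + 0  ∎
  where
  open ≤-Reasoning
  τ-adj-σ : Adj τ σ
  τ-adj-σ = subst (Adj τ) (dist≡0⇒≡ σ τ' d') (adj-sym adj)
  no-fire-in : ¬ (F τ < F σ)
  no-fire-in lt = term (addAt τ 1ℤ F) (τ , σ , τ-adj-σ , inj₂ (inj₁ (refl , lt , λ _ → refl)))
terminal-lower-bound {σ} {k} {F} term Fσ (suc e) τ d with step-toward σ τ (suc e) d
... | τ' , adj , d' = begin
    + k                     ≤⟨ terminal-lower-bound term Fσ e τ' d' ⟩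
    F τ' + + e              ≤⟨ +-monoˡ-≤ (+ e) (i<j⇒i≤pred[j] (≰⇒> no-fire)) ⟩
    pred (F τ + + 2) + + e  ≡⟨ regroup (F τ) (+ e) ⟩
    F τ + + suc e           ∎
  where
  open ≤-Reasoning
  no-fire : ¬ (F τ + + 2 ≤ F τ')
  no-fire h = term (addAt τ 1ℤ (addAt τ' (- 1ℤ) F))
    (τ' , τ , adj , inj₁ (positive-dist⇒≢ σ τ' d' , positive-dist⇒≢ σ τ d , h , λ _ → refl))
  regroup : ∀ x e → -1ℤ + (x + + 2) + e ≡ x + (1ℤ + e)
  regroup = solve-∀

-- A terminal admissible configuration is K•: the invariant bounds every
-- face τ ≠ σ by the cone from above, the lower bound above from below.
terminal-is-finalK : ∀ {σ k F} → Admissible σ k F → Terminal σ F → F ≈ finalK σ k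
terminal-is-finalK {σ} {k} {F} (Fσ , bounded) term τ = case τ ≟F σ of λ
  { (yes refl) → trans Fσ (sym (finalK-σ σ k))
  ; (no τ≢σ)   → trans (≤-antisym (proj₂ (bounded τ τ≢σ)) (⊔-lub (above-slope τ≢σ) (proj₁ (bounded τ τ≢σ))))
                       (sym (finalK-off σ k τ τ≢σ))
  }
  where
  open ≤-Reasoning
  lower : ∀ τ → τ ≢ σ → + k + 1ℤ ≤ F τ + + dist σ τ
  lower τ τ≢σ with dist σ τ in d
  ... | zero  = ⊥-elim (τ≢σ (dist≡0⇒≡ σ τ d))
  ... | suc e = ≤-trans (+-monoˡ-≤ 1ℤ (terminal-lower-bound term Fσ e τ d))
                        (≤-reflexive (regroup (F τ) (+ e)))
    where
    regroup : ∀ x e → x + e + 1ℤ ≡ x + (1ℤ + e)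
    regroup = solve-∀
  above-slope : ∀ {τ} → τ ≢ σ → + k - + dist σ τ + 1ℤ ≤ F τ
  above-slope {τ} τ≢σ = begin
    + k - + dist σ τ + 1ℤ               ≡⟨ swap (+ k) (+ dist σ τ) ⟩
    + k + 1ℤ - + dist σ τ               ≤⟨ +-monoˡ-≤ (- + dist σ τ) (lower τ τ≢σ) ⟩
    F τ + + dist σ τ - + dist σ τ       ≡⟨ cancel (F τ) (+ dist σ τ) ⟩
    F τ                                 ∎
    where
    swap : ∀ k d → k - d + 1ℤ ≡ k + 1ℤ - d
    swap = solve-∀
    cancel : ∀ x d → x + d - d ≡ x
    cancel = solve-∀

theorem6p4 : (σ : Face) (k : ℕ) →
    ((s : ℕ → Config) → s 0 ≈ initK σ k → ¬ (∀ n → Step σ (s n) (s (suc n))))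
    × (∀ F → Reach σ (initK σ k) F → Terminal σ F → F ≈ finalK σ k)
theorem6p4 σ k =
  no-infinite-run σ k ,
  λ F run terminal → terminal-is-finalK (reach-admissible (admissible-initK σ k) run) terminal
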